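{- Let $q$ be a prime power and $m>1$ an integer. Let $L_1(x)\in\mathbb{F}_{q^m}[x]$ be a linearized polynomial which is a permutation polynomial of $\mathbb{F}_{q^m}$, and let $L_2(x)\in\mathbb{F}_{q^m}[x]$ be a linearized polynomial. Let $b\in\mathbb{F}_q$, $\gamma\in\mathbb{F}_{q^m}$, let $h:\mathbb{F}_q\to\mathbb{F}_q$ be a map, and let $f:\mathbb{F}_{q^m}\to\mathbb{F}_q$ be a surjective map such that $L_1^{ -1}(L_2(\gamma))$ is a $b$-linear translator of $f$, where $L_1^{ -1}$ denotes the inverse of the bijection $x\mapsto L_1(x)$ of $\mathbb{F}_{q^m}$. Then $L_1(x)+L_2(\gamma)\,h(f(x))$ is a permutation polynomial of $\mathbb{F}_{q^m}$ if and only if either $L_2(\gamma)=0$ or $x+b\,h(x)$ is a permutation polynomial of $\mathbb{F}_q$.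
   Context: A linearized polynomial over $\mathbb{F}_{q^m}$ is a polynomial $\sum_{i=0}^{m-1}a_ix^{q^i}$ with $a_i\in\mathbb{F}_{q^m}$. Linear translator: for $f:\mathbb{F}_{q^m}\to\mathbb{F}_q$, $a\in\mathbb{F}_q$ and a nonzero $\alpha\in\mathbb{F}_{q^m}$, $\alpha$ is called an $a$-linear translator of $f$ if $f(x+u\alpha)-f(x)=ua$ for all $x\in\mathbb{F}_{q^m}$ and all $u\in\mathbb{F}_q$. A permutation polynomial (or map) of a finite field $K$ is one inducing a bijection of $K$. -}

module Defs where

open import Level using (0ℓ)
open import Data.Nat using (ℕ; zero; suc; _^_; _≥_)
open import Data.Nat.Primality using (Prime)
open import Data.Fin using (Fin)
import Data.Fin as Fin
open import Data.Product using (Σ; ∃; _×_; _,_; proj₁; proj₂)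
open import Relation.Binary.PropositionalEquality using (_≡_; _≢_)
open import Algebra.Structures using (IsCommutativeRing)
open import Function.Bundles using (_⤖_)

IsPrimePower : ℕ → Set
IsPrimePower q = Σ ℕ λ p → Σ ℕ λ k → Prime p × k ≥ 1 × q ≡ p ^ k

record Field : Set₁ where
  infixl 6 _+_
  infixl 7 _*_
  field
    Carrier : Set
    _+_ _*_ : Carrier → Carrier → Carrier
    -_      : Carrier → Carrier
    0# 1#   : Carrier
    isCommutativeRing : IsCommutativeRing _≡_ _+_ _*_ -_ 0# 1#
    0≢1     : 0# ≢ 1#
    inverse : ∀ x → x ≢ 0# → Σ Carrier λ y → x * y ≡ 1#

  _-_ : Carrier → Carrier → Carrier
  x - y = x + (- y)

  _^'_ : Carrier → ℕ → Carrier
  x ^' zero  = 1#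
  x ^' suc n = x * (x ^' n)

HasCard : Field → ℕ → Set
HasCard K n = Fin n ⤖ Field.Carrier K

module _ (K : Field) where
  open Field K

  sumFin : (m : ℕ) → (Fin m → Carrier) → Carrier
  sumFin zero    g = 0#
  sumFin (suc m) g = g Fin.zero + sumFin m (λ i → g (Fin.suc i))

  -- the subfield F_q of K = F_{q^m}: elements with x^q = x
  InSub : ℕ → Carrier → Set
  InSub q x = x ^' q ≡ x

  -- linearized polynomial over K with coefficients a_0..a_{m-1}:
  -- the map x ↦ Σ_{i<m} a_i x^{q^i}
  LinPoly : ℕ → ℕ → Set
  LinPoly q m = Fin m → Carrier

  evalLin : (q m : ℕ) → LinPoly q m → Carrier → Carrier
  evalLin q m a x = sumFin m (λ i → a i * (x ^' (q ^ Fin.toℕ i)))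

  IsPerm : (Carrier → Carrier) → Set
  IsPerm g = (∀ x y → g x ≡ g y → x ≡ y) × (∀ y → Σ Carrier λ x → g x ≡ y)

  invPerm : (g : Carrier → Carrier) → IsPerm g → Carrier → Carrier
  invPerm g p y = proj₁ (proj₂ p y)

  -- a map g : F_q → F_q (represented on K, mapping F_q into F_q) is a permutation of F_q
  IsPermSub : ℕ → (Carrier → Carrier) → Set
  IsPermSub q g =
    (∀ x y → InSub q x → InSub q y → g x ≡ g y → x ≡ y) ×
    (∀ y → InSub q y → Σ Carrier λ x → InSub q x × g x ≡ y)

  IsLinTranslator : ℕ → (Carrier → Carrier) → Carrier → Carrier → Set
  IsLinTranslator q f a α =
    α ≢ 0# × (∀ x u → InSub q u → f (x + u * α) - f x ≡ u * a)

module Submission where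

-- Structure of the proof.
--   1. (PrimeBinomial) p divides p C j for a prime p and 0 < j < p.
--   2. (FieldTheory) A field with N elements satisfies N·1 = 0 (summing all
--      elements is invariant under x ↦ x + 1).  If N = q^m with q = p^k,
--      then p·1 is nilpotent, hence zero, so x ↦ x^p is additive
--      (Frobenius, by 1.) and so is x ↦ x^q.  Consequently every
--      linearized polynomial L is F_q-semilinear: L(x + c·α) = L(x) + c·L(α)
--      for c ∈ F_q.
--   3. By semilinearity F = L₁ ∘ G with G(x) = x + h(f(x))·α, so F permutes
--      K iff G does, L₁ being a permutation; if A = 0 then F = L₁.
--   4. (Translator) The translator property gives f ∘ G = P ∘ f, from which
--      G permutes K iff P permutes F_q.

open import Defs
open import Data.Nat using (ℕ; _^_; _>_)
open import Data.Product using (Σ; _×_)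
open import Data.Sum using (_⊎_)
open import Relation.Binary.PropositionalEquality using (_≡_; sym)
open import Function.Bundles using (_⇔_; mk⇔)
open import Data.Product using (_,_; proj₁; proj₂)
open import Data.Sum using (inj₁; inj₂; [_,_])
open import Function.Base using (_∘_)

module PrimeBinomial where
  open import Data.Nat
  open import Data.Nat.Properties using (*-zeroʳ; *-identityˡ; *-identityʳ; *-comm; <⇒≱)
  open import Data.Nat.Combinatorics
  open import Data.Nat.Divisibility using (_∣_; divides; ∣⇒≤)
  open import Data.Nat.Primality using (Prime; euclidsLemma)
  open import Data.Empty using (⊥-elim)
  open import Relation.Binary.PropositionalEquality
  open import Data.Nat.Tactic.RingSolver using (solve-∀)

  absorption : ∀ n k → suc k * (suc n C suc k) ≡ suc n * (n C k)
  absorption zero    zero    = refl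
  absorption zero    (suc k) = trans (*-zeroʳ (suc (suc k)))
    (sym (trans (*-identityˡ _) (k>n⇒nCk≡0 {0} {suc k} (s≤s z≤n))))
  absorption (suc n) zero    =
    trans (*-identityˡ _) (trans (nC1≡n (suc (suc n))) (sym (*-identityʳ _)))
  absorption (suc n) (suc k) = begin
    (2 + k) * (suc (suc n) C suc (suc k))  ≡⟨ cong ((2 + k) *_) (sym (pascal (suc n) (suc k))) ⟩
    (2 + k) * (a + b)                      ≡⟨ split-left k a b ⟩
    (1 + k) * a + a + (2 + k) * b          ≡⟨ cong₂ (λ X Y → X + a + Y) (absorption n k) (absorption n (suc k)) ⟩
    (1 + n) * c + a + (1 + n) * d          ≡⟨ regroup n c a d ⟩
    (1 + n) * (c + d) + a                  ≡⟨ cong (λ X → (1 + n) * X + a) (pascal n k) ⟩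
    (1 + n) * a + a                        ≡⟨ merge n a ⟩
    (2 + n) * a                            ∎
    where
    open ≡-Reasoning
    pascal = nCk+nC[k+1]≡[n+1]C[k+1]
    a = suc n C suc k
    b = suc n C suc (suc k)
    c = n C k
    d = n C suc k
    split-left : ∀ k a b → (2 + k) * (a + b) ≡ (1 + k) * a + a + (2 + k) * b
    split-left = solve-∀
    regroup : ∀ n c a d → (1 + n) * c + a + (1 + n) * d ≡ (1 + n) * (c + d) + a
    regroup = solve-∀
    merge : ∀ n a → (1 + n) * a + a ≡ (2 + n) * a
    merge = solve-∀

  -- j·C(p, j) = p·C(p-1, j-1) is divisible by p, and p ∤ j since 0 < j < p.
  prime∣C : ∀ {p} → Prime p → ∀ j → 0 < j → j < p → p ∣ p C j
  prime∣C {suc p′} pr (suc j′) _ j<p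
    with euclidsLemma (suc j′) (suc p′ C suc j′) pr
           (divides (p′ C j′) (trans (absorption p′ j′) (*-comm (suc p′) _)))
  ... | inj₂ p∣C = p∣C
  ... | inj₁ p∣j = ⊥-elim (<⇒≱ j<p (∣⇒≤ p∣j))

open PrimeBinomial using (prime∣C)

module FieldTheory (K : Field) where
  open Field K
  open import Level using (0ℓ)
  open import Algebra.Bundles using (CommutativeRing)
  open import Relation.Binary.PropositionalEquality
  open import Relation.Nullary using (yes; no)
  open import Relation.Binary using (Decidable)
  open import Data.Empty using (⊥-elim)
  open import Data.Nat as ℕ using (zero; suc; z≤n; s≤s)
  import Data.Nat.Properties as ℕP
  open import Data.Nat.Primality using (Prime)
  open import Data.Nat.Divisibility using (divides)
  open import Data.Nat.Combinatorics using (_C_; nCn≡1)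
  open import Data.Fin as Fin using (Fin; toℕ; fromℕ; inject₁)
  import Data.Fin.Properties as FinP
  open import Function.Bundles using (_↔_; Inverse; mk↔ₛ′)
  open import Function.Properties.Bijection using (⤖⇒↔)
  open import Function.Properties.Inverse using (↔-sym; ↔-trans; ↔⇒↣)

  ring : CommutativeRing 0ℓ 0ℓ
  ring = record { isCommutativeRing = isCommutativeRing }
  module R = CommutativeRing ring
  open import Algebra.Properties.Semiring.Exp R.semiring using (^-assocʳ) renaming (_^_ to _^ᴷ_)
  open import Algebra.Properties.CommutativeSemiring.Exp R.commutativeSemiring using (^-distrib-*)
  open import Algebra.Properties.Semiring.Mult R.semiring using (×-assoc-*; ×1-homo-*) renaming (_×_ to _·_)
  open import Algebra.Properties.Monoid.Mult R.+-monoid using (×-assocˡ)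
  open import Algebra.Properties.Semiring.Sum R.semiring using (sum; sum-cong-≗; ∑-distrib-+; *-distribˡ-sum; sum-permute; sum-replicate; sum-init-last; sum-replicate-zero)
  import Algebra.Properties.CommutativeSemiring.Binomial R.commutativeSemiring as Binomial
  open import Algebra.Properties.Group R.+-group using (//-rightDividesˡ; //-rightDividesʳ; ∙-cancelʳ)
  open import Algebra.Properties.CommutativeSemigroup R.+-commutativeSemigroup using (xy∙z≈xz∙y)
  open import Algebra.Properties.CommutativeSemigroup R.*-commutativeSemigroup using (x∙yz≈y∙xz)
  open ≡-Reasoning

  sub-add : ∀ x y → (y - x) + x ≡ y
  sub-add = //-rightDividesˡ

  add-sub : ∀ x y → (y + x) - x ≡ y
  add-sub = //-rightDividesʳ

  +-cancelʳ : ∀ {x y} z → x + z ≡ y + z → x ≡ y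
  +-cancelʳ z = ∙-cancelʳ z _ _

  +-swapʳ : ∀ x y z → (x + y) + z ≡ (x + z) + y
  +-swapʳ = xy∙z≈xz∙y

  ^'≡^ : ∀ x n → x ^' n ≡ x ^ᴷ n
  ^'≡^ x zero    = refl
  ^'≡^ x (suc n) = cong (x *_) (^'≡^ x n)

  sumFin≡sum : ∀ n (g : Fin n → Carrier) → sumFin K n g ≡ sum g
  sumFin≡sum zero    g = refl
  sumFin≡sum (suc n) g = cong (g Fin.zero +_) (sumFin≡sum n (g ∘ Fin.suc))

  -- In a field a nilpotent element is zero (given decidable equality, which
  -- lets us invert a non-zero element).
  nilpotent⇒zero : Decidable (_≡_ {A = Carrier}) → ∀ z n → z ^ᴷ n ≡ 0# → z ≡ 0#
  nilpotent⇒zero _≟_ z zero    zⁿ≡0 = ⊥-elim (0≢1 (sym zⁿ≡0))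
  nilpotent⇒zero _≟_ z (suc n) zⁿ≡0 with z ≟ 0#
  ... | yes z≡0 = z≡0
  ... | no  z≢0 = nilpotent⇒zero _≟_ z n (begin
    z ^ᴷ n                ≡⟨ sym (R.*-identityˡ _) ⟩
    1# * z ^ᴷ n           ≡⟨ cong (_* z ^ᴷ n) (trans (sym z*z⁻¹≡1) (R.*-comm z z⁻¹)) ⟩
    (z⁻¹ * z) * z ^ᴷ n    ≡⟨ R.*-assoc z⁻¹ z _ ⟩
    z⁻¹ * (z * z ^ᴷ n)    ≡⟨ cong (z⁻¹ *_) zⁿ≡0 ⟩
    z⁻¹ * 0#              ≡⟨ R.zeroʳ z⁻¹ ⟩
    0#                    ∎)
    where
    z⁻¹ = proj₁ (inverse z z≢0)
    z*z⁻¹≡1 = proj₂ (inverse z z≢0)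

  ·1-^ : ∀ a n → (a · 1#) ^ᴷ n ≡ (a ℕ.^ n) · 1#
  ·1-^ a zero    = sym (R.+-identityʳ 1#)
  ·1-^ a (suc n) = trans (cong ((a · 1#) *_) (·1-^ a n)) (sym (×1-homo-* a (a ℕ.^ n)))

  -- A field with N elements has N·1 = 0: translating by 1 permutes the
  -- elements, so Σ x = Σ (x + 1) = Σ x + N·1.
  module FiniteField {N : ℕ.ℕ} (card : HasCard K N) where
    enum : Fin N ↔ Carrier
    enum = ⤖⇒↔ card
    open Inverse enum using (to; from)

    _≟_ : Decidable (_≡_ {A = Carrier})
    _≟_ = FinP.inj⇒≟ (↔⇒↣ (↔-sym enum))

    shift : Carrier ↔ Carrier
    shift = mk↔ₛ′ (_+ 1#) (_- 1#) (sub-add 1#) (add-sub 1#)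

    card·1≡0 : N · 1# ≡ 0#
    card·1≡0 = sym (+-cancelʳ (sum to) (begin
      0# + sum to                   ≡⟨ R.+-identityˡ _ ⟩
      sum to                        ≡⟨ sum-permute to (↔-trans enum (↔-trans shift (↔-sym enum))) ⟩
      sum {N} (λ i → to (from (to i + 1#)))
                                    ≡⟨ sum-cong-≗ (λ i → Inverse.strictlyInverseˡ enum (to i + 1#)) ⟩
      sum {N} (λ i → to i + 1#)     ≡⟨ ∑-distrib-+ to (λ _ → 1#) ⟩
      sum to + sum {N} (λ _ → 1#)   ≡⟨ cong (sum to +_) (sum-replicate N) ⟩
      sum to + N · 1#               ≡⟨ R.+-comm _ _ ⟩
      N · 1# + sum to               ∎))

  AdditivePower : ℕ.ℕ → Set
  AdditivePower e = ∀ x y → (x + y) ^ᴷ e ≡ x ^ᴷ e + y ^ᴷ e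

  -- Frobenius: if p is prime and p·1 = 0 then x ↦ x^p is additive, since
  -- every inner binomial coefficient p C j is a multiple of p.
  frobenius : ∀ {p} → Prime p → p · 1# ≡ 0# → AdditivePower p
  frobenius {p@(suc (suc r))} pr p·1≡0 x y = begin
    (x + y) ^ᴷ p               ≡⟨ Binomial.theorem p x y ⟩
    sum t                      ≡⟨ sum-init-last t ⟩
    (t Fin.zero + sum inner) + t (fromℕ p)
                               ≡⟨ cong₂ (λ X Y → (t Fin.zero + X) + Y) inner≡0 last≡xᵖ ⟩
    (t Fin.zero + 0#) + x ^ᴷ p ≡⟨ cong (_+ x ^ᴷ p) (trans (R.+-identityʳ _) first≡yᵖ) ⟩
    y ^ᴷ p + x ^ᴷ p            ≡⟨ R.+-comm _ _ ⟩
    x ^ᴷ p + y ^ᴷ p            ∎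
    where
    t : Fin (suc p) → Carrier
    t = Binomial.binomialTerm x y p
    inner : Fin (suc r) → Carrier
    inner i = t (inject₁ (Fin.suc i))
    first≡yᵖ : t Fin.zero ≡ y ^ᴷ p
    first≡yᵖ = trans (R.+-identityʳ _) (R.*-identityˡ _)
    last≡xᵖ : t (fromℕ p) ≡ x ^ᴷ p
    last≡xᵖ = begin
      t (fromℕ p)                                 ≡⟨ cong (λ j → (p C j) · (x ^ᴷ j * y ^ᴷ (p ℕ.∸ j))) (FinP.toℕ-fromℕ p) ⟩
      (p C p) · (x ^ᴷ p * y ^ᴷ (p ℕ.∸ p))         ≡⟨ cong₂ (λ c e → c · (x ^ᴷ p * y ^ᴷ e)) (nCn≡1 p) (ℕP.n∸n≡0 p) ⟩
      1 · (x ^ᴷ p * 1#)                           ≡⟨ trans (R.+-identityʳ _) (R.*-identityʳ _) ⟩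
      x ^ᴷ p                                      ∎
    p·z≡0 : ∀ z → p · z ≡ 0#
    p·z≡0 z = begin
      p · z           ≡⟨ cong (p ·_) (sym (R.*-identityˡ z)) ⟩
      p · (1# * z)    ≡⟨ sym (×-assoc-* p 1# z) ⟩
      (p · 1#) * z    ≡⟨ cong (_* z) p·1≡0 ⟩
      0# * z          ≡⟨ R.zeroˡ z ⟩
      0#              ∎
    inner-vanishes : ∀ i → inner i ≡ 0#
    inner-vanishes i with prime∣C pr (suc (toℕ i)) (s≤s z≤n) (FinP.toℕ<n (Fin.suc i))
    ... | divides c pC≡c*p = begin
      inner i            ≡⟨ cong (λ k → (p C k) · (x ^ᴷ k * y ^ᴷ (p ℕ.∸ k))) (FinP.toℕ-inject₁ (Fin.suc i)) ⟩
      (p C j) · w        ≡⟨ cong (_· w) (trans pC≡c*p (ℕP.*-comm c p)) ⟩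
      (p ℕ.* c) · w      ≡⟨ sym (×-assocˡ w p c) ⟩
      p · (c · w)        ≡⟨ p·z≡0 (c · w) ⟩
      0#                 ∎
      where
      j = suc (toℕ i)
      w = x ^ᴷ j * y ^ᴷ (p ℕ.∸ j)
    inner≡0 : sum inner ≡ 0#
    inner≡0 = trans (sum-cong-≗ inner-vanishes) (sum-replicate-zero (suc r))

  additive-^ : ∀ {e} → AdditivePower e → ∀ i → AdditivePower (e ℕ.^ i)
  additive-^ _ zero x y =
    trans (R.*-identityʳ _) (sym (cong₂ _+_ (R.*-identityʳ x) (R.*-identityʳ y)))
  additive-^ {e} additive (suc i) x y = begin
    (x + y) ^ᴷ (e ℕ.* eⁱ)               ≡⟨ sym (^-assocʳ (x + y) e eⁱ) ⟩
    ((x + y) ^ᴷ e) ^ᴷ eⁱ                ≡⟨ cong (_^ᴷ eⁱ) (additive x y) ⟩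
    (x ^ᴷ e + y ^ᴷ e) ^ᴷ eⁱ             ≡⟨ additive-^ additive i _ _ ⟩
    (x ^ᴷ e) ^ᴷ eⁱ + (y ^ᴷ e) ^ᴷ eⁱ     ≡⟨ cong₂ _+_ (^-assocʳ x e eⁱ) (^-assocʳ y e eⁱ) ⟩
    x ^ᴷ (e ℕ.* eⁱ) + y ^ᴷ (e ℕ.* eⁱ)   ∎
    where eⁱ = e ℕ.^ i

  -- In a field with q^m elements, q = p^k a prime power, we have p·1 = 0
  -- (p·1 is nilpotent: (p·1)^(km) = q^m·1 = 0), so x ↦ x^q is additive.
  prime-power-field⇒additive : ∀ {q m} → IsPrimePower q → HasCard K (q ℕ.^ m) →
                               AdditivePower q
  prime-power-field⇒additive {q} {m} (p , k , pr , _ , q≡pᵏ) card =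
    subst AdditivePower (sym q≡pᵏ) (additive-^ (frobenius pr p·1≡0) k)
    where
    open FiniteField card using (_≟_; card·1≡0)
    p·1≡0 : p · 1# ≡ 0#
    p·1≡0 = nilpotent⇒zero _≟_ (p · 1#) (k ℕ.* m) (begin
      (p · 1#) ^ᴷ (k ℕ.* m)    ≡⟨ ·1-^ p (k ℕ.* m) ⟩
      (p ℕ.^ (k ℕ.* m)) · 1#   ≡⟨ cong (_· 1#) (sym (ℕP.^-*-assoc p k m)) ⟩
      ((p ℕ.^ k) ℕ.^ m) · 1#   ≡⟨ cong (λ n → (n ℕ.^ m) · 1#) (sym q≡pᵏ) ⟩
      (q ℕ.^ m) · 1#           ≡⟨ card·1≡0 ⟩
      0#                       ∎)

  InSub-fixed : ∀ {q c} → InSub K q c → ∀ i → c ^ᴷ (q ℕ.^ i) ≡ c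
  InSub-fixed cq zero = R.*-identityʳ _
  InSub-fixed {q} {c} cq (suc i) = begin
    c ^ᴷ (q ℕ.* q ℕ.^ i)    ≡⟨ sym (^-assocʳ c q _) ⟩
    (c ^ᴷ q) ^ᴷ (q ℕ.^ i)   ≡⟨ cong (_^ᴷ (q ℕ.^ i)) (trans (sym (^'≡^ c q)) cq) ⟩
    c ^ᴷ (q ℕ.^ i)          ≡⟨ InSub-fixed cq i ⟩
    c                       ∎

  evalLin≡sum : ∀ q m (a : LinPoly K q m) x →
                evalLin K q m a x ≡ sum (λ i → a i * x ^ᴷ (q ℕ.^ toℕ i))
  evalLin≡sum q m a x =
    trans (sumFin≡sum m _) (sum-cong-≗ (λ i → cong (a i *_) (^'≡^ x (q ℕ.^ toℕ i))))

  evalLin-semilinear : ∀ {q} m (a : LinPoly K q m) → AdditivePower q →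
    ∀ x c α → InSub K q c →
    evalLin K q m a (x + c * α) ≡ evalLin K q m a x + c * evalLin K q m a α
  evalLin-semilinear {q} m a additive x c α cq = begin
    evalLin K q m a (x + c * α)
      ≡⟨ evalLin≡sum q m a _ ⟩
    sum {m} (λ i → a i * (x + c * α) ^ᴷ e i)
      ≡⟨ sum-cong-≗ monomial ⟩
    sum {m} (λ i → a i * x ^ᴷ e i + c * (a i * α ^ᴷ e i))
      ≡⟨ ∑-distrib-+ (λ i → a i * x ^ᴷ e i) (λ i → c * (a i * α ^ᴷ e i)) ⟩
    sum {m} (λ i → a i * x ^ᴷ e i) + sum {m} (λ i → c * (a i * α ^ᴷ e i))
      ≡⟨ cong₂ _+_ (sym (evalLin≡sum q m a x)) (sym (*-distribˡ-sum c (λ i → a i * α ^ᴷ e i))) ⟩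
    evalLin K q m a x + c * sum {m} (λ i → a i * α ^ᴷ e i)
      ≡⟨ cong (λ s → evalLin K q m a x + c * s) (sym (evalLin≡sum q m a α)) ⟩
    evalLin K q m a x + c * evalLin K q m a α
      ∎
    where
    e : Fin m → ℕ.ℕ
    e i = q ℕ.^ toℕ i
    monomial : ∀ i → a i * (x + c * α) ^ᴷ e i ≡ a i * x ^ᴷ e i + c * (a i * α ^ᴷ e i)
    monomial i = begin
      a i * (x + c * α) ^ᴷ e i              ≡⟨ cong (a i *_) (additive-^ additive (toℕ i) x (c * α)) ⟩
      a i * (x ^ᴷ e i + (c * α) ^ᴷ e i)     ≡⟨ cong (λ z → a i * (x ^ᴷ e i + z)) (^-distrib-* c α (e i)) ⟩
      a i * (x ^ᴷ e i + c ^ᴷ e i * α ^ᴷ e i) ≡⟨ cong (λ z → a i * (x ^ᴷ e i + z * α ^ᴷ e i)) (InSub-fixed cq (toℕ i)) ⟩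
      a i * (x ^ᴷ e i + c * α ^ᴷ e i)       ≡⟨ R.distribˡ _ _ _ ⟩
      a i * x ^ᴷ e i + a i * (c * α ^ᴷ e i) ≡⟨ cong (a i * x ^ᴷ e i +_) (x∙yz≈y∙xz (a i) c _) ⟩
      a i * x ^ᴷ e i + c * (a i * α ^ᴷ e i) ∎

  +-0*-elim : ∀ {A} → A ≡ 0# → ∀ y c → y + A * c ≡ y
  +-0*-elim A≡0 y c =
    trans (cong (λ a → y + a * c) A≡0) (trans (cong (y +_) (R.zeroˡ c)) (R.+-identityʳ y))

  IsPerm-≗ : ∀ {F G} → (∀ x → F x ≡ G x) → IsPerm K F → IsPerm K G
  IsPerm-≗ F≗G (F-inj , F-onto) =
    (λ x y Gx≡Gy → F-inj x y (trans (F≗G x) (trans Gx≡Gy (sym (F≗G y))))) ,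
    (λ z → proj₁ (F-onto z) , trans (sym (F≗G _)) (proj₂ (F-onto z)))

  IsPerm-∘ : ∀ {L G} → IsPerm K L → IsPerm K G → IsPerm K (L ∘ G)
  IsPerm-∘ {L} (L-inj , L-onto) (G-inj , G-onto) =
    (λ x y LGx≡LGy → G-inj x y (L-inj _ _ LGx≡LGy)) ,
    (λ z → let y = proj₁ (L-onto z) in
           proj₁ (G-onto y) , trans (cong L (proj₂ (G-onto y))) (proj₂ (L-onto z)))

  IsPerm-∘⁻ : ∀ {L G} → (∀ x y → L x ≡ L y → x ≡ y) → IsPerm K (L ∘ G) → IsPerm K G
  IsPerm-∘⁻ {L} L-inj (LG-inj , LG-onto) =
    (λ x y Gx≡Gy → LG-inj x y (cong L Gx≡Gy)) ,
    (λ z → proj₁ (LG-onto (L z)) , L-inj _ _ (proj₂ (LG-onto (L z))))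

  semilinear-absorb : ∀ {q} (L : Carrier → Carrier) (L-perm : IsPerm K L) →
    (∀ x c α → InSub K q c → L (x + c * α) ≡ L x + c * L α) →
    ∀ A (c : Carrier → Carrier) → (∀ x → InSub K q (c x)) →
    ∀ x → L x + A * c x ≡ L (x + c x * invPerm K L L-perm A)
  semilinear-absorb L L-perm semilinear A c c-sub x = sym (begin
    L (x + c x * α)    ≡⟨ semilinear x (c x) α (c-sub x) ⟩
    L x + c x * L α    ≡⟨ cong (λ z → L x + c x * z) (proj₂ (proj₂ L-perm A)) ⟩
    L x + c x * A      ≡⟨ cong (L x +_) (R.*-comm (c x) A) ⟩
    L x + A * c x      ∎)
    where α = invPerm K L L-perm A

  module Translator (q : ℕ.ℕ) (f h : Carrier → Carrier) (b α : Carrier)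
    (translator : IsLinTranslator K q f b α)
    (f-sub : ∀ x → InSub K q (f x))
    (f-onto : ∀ y → InSub K q y → Σ Carrier (λ x → f x ≡ y))
    (h-sub : ∀ u → InSub K q u → InSub K q (h u)) where

    G P : Carrier → Carrier
    G x = x + h (f x) * α
    P u = u + b * h u

    translate : ∀ x u → InSub K q u → f (x + u * α) ≡ f x + u * b
    translate x u u-sub = begin
      f (x + u * α)                   ≡⟨ sym (sub-add (f x) _) ⟩
      (f (x + u * α) - f x) + f x     ≡⟨ cong (_+ f x) (proj₂ translator x u u-sub) ⟩
      u * b + f x                     ≡⟨ R.+-comm _ _ ⟩
      f x + u * b                     ∎

    translate⁻ : ∀ x u → InSub K q u → f (x - (u * α)) + u * b ≡ f x
    translate⁻ x u u-sub =
      trans (sym (translate (x - (u * α)) u u-sub)) (cong f (sub-add (u * α) x))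

    f∘G≡P∘f : ∀ x → f (G x) ≡ P (f x)
    f∘G≡P∘f x = trans (translate x (h (f x)) (h-sub _ (f-sub x))) (cong (f x +_) (R.*-comm _ b))

    G-perm⇒P-perm : IsPerm K G → IsPermSub K q P
    G-perm⇒P-perm (G-inj , G-onto) = P-inj , P-onto
      where
      -- Given P u = P v, pick x with f x = u and put y = (x - h(v)·α) + h(u)·α;
      -- then f y = v and G y = G x, so y = x and hence u = v.
      P-inj : ∀ u v → InSub K q u → InSub K q v → P u ≡ P v → u ≡ v
      P-inj u v u-sub v-sub Pu≡Pv = trans (sym fx≡u) (trans (cong f (sym y≡x)) fy≡v)
        where
        x = proj₁ (f-onto u u-sub)
        fx≡u = proj₂ (f-onto u u-sub)
        x₀ = x - (h v * α)
        y = x₀ + h u * α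
        fy≡v : f y ≡ v
        fy≡v = +-cancelʳ (h v * b) (begin
          f y + h v * b                ≡⟨ cong (_+ h v * b) (translate x₀ (h u) (h-sub u u-sub)) ⟩
          (f x₀ + h u * b) + h v * b   ≡⟨ +-swapʳ _ _ _ ⟩
          (f x₀ + h v * b) + h u * b   ≡⟨ cong (_+ h u * b) (trans (translate⁻ x (h v) (h-sub v v-sub)) fx≡u) ⟩
          u + h u * b                  ≡⟨ cong (u +_) (R.*-comm _ b) ⟩
          P u                          ≡⟨ Pu≡Pv ⟩
          P v                          ≡⟨ cong (v +_) (R.*-comm b _) ⟩
          v + h v * b                  ∎)
        Gy≡Gx : G y ≡ G x
        Gy≡Gx = begin
          y + h (f y) * α              ≡⟨ cong (λ t → y + h t * α) fy≡v ⟩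
          (x₀ + h u * α) + h v * α     ≡⟨ +-swapʳ _ _ _ ⟩
          (x₀ + h v * α) + h u * α     ≡⟨ cong (_+ h u * α) (sub-add (h v * α) x) ⟩
          x + h u * α                  ≡⟨ cong (λ t → x + h t * α) (sym fx≡u) ⟩
          G x                          ∎
        y≡x = G-inj y x Gy≡Gx
      P-onto : ∀ w → InSub K q w → Σ Carrier (λ u → InSub K q u × P u ≡ w)
      P-onto w w-sub = f x , f-sub x , trans (sym (f∘G≡P∘f x)) (trans (cong f Gx≡z) fz≡w)
        where
        z = proj₁ (f-onto w w-sub)
        fz≡w = proj₂ (f-onto w w-sub)
        x = proj₁ (G-onto z)
        Gx≡z = proj₂ (G-onto z)

    P-perm⇒G-perm : IsPermSub K q P → IsPerm K G
    P-perm⇒G-perm (P-inj , P-onto) = G-inj , G-onto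
      where
      G-inj : ∀ x y → G x ≡ G y → x ≡ y
      G-inj x y Gx≡Gy =
        +-cancelʳ (h (f x) * α) (trans Gx≡Gy (cong (λ t → y + h t * α) (sym fx≡fy)))
        where
        fx≡fy = P-inj _ _ (f-sub x) (f-sub y)
                  (trans (sym (f∘G≡P∘f x)) (trans (cong f Gx≡Gy) (f∘G≡P∘f y)))
      -- Solve P u = f z in F_q; then x = z - h(u)·α has f x = u, so G x = z.
      G-onto : ∀ z → Σ Carrier (λ x → G x ≡ z)
      G-onto z = x , trans (cong (λ t → x + h t * α) fx≡u) (sub-add (h u * α) z)
        where
        u = proj₁ (P-onto (f z) (f-sub z))
        u-sub = proj₁ (proj₂ (P-onto (f z) (f-sub z)))
        Pu≡fz = proj₂ (proj₂ (P-onto (f z) (f-sub z)))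
        x = z - (h u * α)
        fx≡u : f x ≡ u
        fx≡u = +-cancelʳ (h u * b)
          (trans (translate⁻ z (h u) (h-sub u u-sub)) (trans (sym Pu≡fz) (cong (u +_) (R.*-comm b _))))

theorem4p1 : (q m : ℕ) → IsPrimePower q → m > 1 →
    (K : Field) → HasCard K (q ^ m) →
    (L₁ L₂ : LinPoly K q m) →
    (permL₁ : IsPerm K (evalLin K q m L₁)) →
    (b γ : Field.Carrier K) → InSub K q b →
    (h : Field.Carrier K → Field.Carrier K) →
    (∀ x → InSub K q x → InSub K q (h x)) →
    (f : Field.Carrier K → Field.Carrier K) →
    (∀ x → InSub K q (f x)) →
    (∀ y → InSub K q y → Σ (Field.Carrier K) (λ x → f x ≡ y)) →
    IsLinTranslator K q f b
      (invPerm K (evalLin K q m L₁) permL₁ (evalLin K q m L₂ γ)) →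
    IsPerm K (λ x → Field._+_ K (evalLin K q m L₁ x)
                      (Field._*_ K (evalLin K q m L₂ γ) (h (f x))))
    ⇔ (evalLin K q m L₂ γ ≡ Field.0# K
        ⊎ IsPermSub K q (λ x → Field._+_ K x (Field._*_ K b (h x))))
theorem4p1 q m q-prime-power _ K card L₁ L₂ L₁-perm b γ _ h h-sub f f-sub f-onto translator =
  -- F perm ⇒ G perm ⇒ P perm;  A = 0 ⇒ F = L₁;  P perm ⇒ G perm ⇒ F = L₁ ∘ G perm.
  mk⇔ (λ F-perm → inj₂ (G-perm⇒P-perm (IsPerm-∘⁻ (proj₁ L₁-perm) (IsPerm-≗ F≗L∘G F-perm))))
      [ (λ A≡0 → IsPerm-≗ (λ x → sym (+-0*-elim A≡0 (L x) (h (f x)))) L₁-perm)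
      , (λ P-perm → IsPerm-≗ (sym ∘ F≗L∘G) (IsPerm-∘ L₁-perm (P-perm⇒G-perm P-perm))) ]
  where
  open Field K using (_+_; _*_)
  open FieldTheory K
  L = evalLin K q m L₁
  A = evalLin K q m L₂ γ
  open Translator q f h b (invPerm K L L₁-perm A) translator f-sub f-onto h-sub
  -- F = L ∘ G, because L is F_q-semilinear and h (f x) ∈ F_q.
  F≗L∘G : ∀ x → L x + A * h (f x) ≡ L (G x)
  F≗L∘G = semilinear-absorb {q} L L₁-perm
            (evalLin-semilinear m L₁ (prime-power-field⇒additive {q} {m} q-prime-power card))
            A (h ∘ f) (λ x → h-sub _ (f-sub x))
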